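{- Let $\lambda$ be a triangular partition and $\theta$ its triangular Young tableau. Then for every subpartition $\mu\subseteq\lambda$, the $\theta$-deficit cells of $(\lambda,\mu)$ are exactly the non-similar cells of $\mu$. In particular $|\lambda|=\mathrm{area}(\lambda,\mu)+\mathrm{sim}(\lambda,\mu)+\mathrm{def}_\theta(\mu)$.
   Context: Partitions are drawn in French convention: cell $(\ell,c)$ ($\ell\ge0$ row from the bottom, $c\ge0$ column) belongs to $\lambda$ iff $c<\lambda_{\ell+1}$. A partition is triangular if there are positive reals $r,s$ with $\lambda_j=\lfloor r-jr/s\rfloor$ for integers $1\le j\le s$ and $\lambda_j=0$ for $j>s$. For a cell $c$ of a partition $\mu$, arm $a(c)$ (resp. leg $\ell(c)$) is the number of cells of $\mu$ strictly right of $c$ in its row (resp. strictly above $c$ in its column); $v^-(c,\mu)=\ell(c)/(a(c)+\ell(c)+1)$, $v^+(c,\mu)=(\ell(c)+1)/(a(c)+\ell(c)+1)$; $v^-_\lambda=\max_{c\in\lambda}v^-(c,\lambda)$, $v^+_\lambda=\min_{c\in\lambda}v^+(c,\lambda)$. For a subpartition $\mu\subseteq\lambda$ (i.e. $\mu_i\le\lambda_i$ for all $i$), $\mathrm{area}(\lambda,\mu)=|\lambda|-|\mu|$; a cell $c$ of $\mu$ is similar if $v^-(c,\mu)<\frac{v^-_\lambda+v^+_\lambda}{2}\le v^+(c,\mu)$, and $\mathrm{sim}(\lambda,\mu)$ is the number of similar cells of $\mu$. $(\lambda,\mu)$ is mean-similar if all cells of $\mu$ are similar. The triangular Young tableau of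 $\lambda$ is the unique standard Young tableau $\theta$ of shape $\lambda$ such that for every $0\le k\le|\lambda|$ the cells with labels $\le k$ form a subpartition $\mu$ with $(\lambda,\mu)$ mean-similar. For a standard Young tableau $\theta$ of shape $\lambda$, a cell $d$ is a $\theta$-deficit cell of $(\lambda,\mu)$ if there exist cells $c_1=(i_1,j_1)\in\mu$ and $c_2=(i_2,j_2)\in\lambda\setminus\mu$ with $\theta(c_1)>\theta(c_2)$ and $d=(\min(i_1,i_2),\min(j_1,j_2))$; $\mathrm{def}_\theta(\mu)$ is the number of $\theta$-deficit cells.
   Formalization: In the definition of a triangular partition, the parameters $r,s$ range over the positive rationals rather than the positive reals. -}

module Defs where

open import Data.Nat as ℕ using (ℕ; zero; suc; _+_; _∸_; _⊓_; _<?_)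
open import Data.Integer as ℤ using (ℤ; +_)
open import Data.Rational as ℚ using (ℚ; 0ℚ; 1ℚ; ½; floor; _÷_)
open import Data.Rational.Properties using (pos⇒nonZero)
open import Data.List using (List; []; _∷_; length; map; concatMap; upTo; drop; filter; foldr)
open import Data.Nat.ListAction using (sum)
open import Data.List.Relation.Unary.Unique.Propositional using (Unique)
open import Data.List.Membership.Propositional using (_∈_)
open import Data.Product using (Σ; _×_; _,_)
open import Function.Bundles using (_⇔_)
open import Relation.Nullary using (¬_; Dec)
open import Relation.Nullary.Decidable using (_×-dec_)
open import Relation.Binary.PropositionalEquality using (_≡_)

-- A partition is given by the list of its row lengths (λ₁, λ₂, …);
-- entries beyond the end of the list are 0 (trailing zeros are harmless).
-- row λ ℓ = λ_{ℓ+1}  (0-indexed rows, French convention).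
row : List ℕ → ℕ → ℕ
row []       _       = 0
row (x ∷ _)  zero    = x
row (_ ∷ xs) (suc i) = row xs i

IsPartition : List ℕ → Set
IsPartition λ' = ∀ i → row λ' (suc i) ℕ.≤ row λ' i

size : List ℕ → ℕ
size = sum

Cell : Set
Cell = ℕ × ℕ   -- (ℓ , c) : row ℓ, column c

_∈ₚ_ : Cell → List ℕ → Set
(ℓ , c) ∈ₚ λ' = c ℕ.< row λ' ℓ

_⊆ₚ_ : List ℕ → List ℕ → Set
μ ⊆ₚ λ' = ∀ i → row μ i ℕ.≤ row λ' i

cells : List ℕ → List Cell
cells λ' = concatMap (λ ℓ → map (λ c → (ℓ , c)) (upTo (row λ' ℓ))) (upTo (length λ'))

arm : List ℕ → Cell → ℕ
arm μ (ℓ , c) = row μ ℓ ∸ suc c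

leg : List ℕ → Cell → ℕ
leg μ (ℓ , c) = length (filter (λ ℓ' → c <? row μ ℓ') (drop (suc ℓ) (upTo (length μ))))

v⁻ : List ℕ → Cell → ℚ
v⁻ μ x = (+ leg μ x) ℚ./ suc (arm μ x + leg μ x)

v⁺ : List ℕ → Cell → ℚ
v⁺ μ x = (+ suc (leg μ x)) ℚ./ suc (arm μ x + leg μ x)

-- v⁻_λ = max over cells, v⁺_λ = min over cells
-- (the defaults 0 and 1 are neutral since 0 ≤ v⁻ and v⁺ ≤ 1; they only
--  matter for the empty partition, where no cell exists anyway)
v⁻max : List ℕ → ℚ
v⁻max λ' = foldr ℚ._⊔_ 0ℚ (map (v⁻ λ') (cells λ'))

v⁺min : List ℕ → ℚ
v⁺min λ' = foldr ℚ._⊓_ 1ℚ (map (v⁺ λ') (cells λ'))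

meanSlope : List ℕ → ℚ
meanSlope λ' = (v⁻max λ' ℚ.+ v⁺min λ') ℚ.* ½

Similar : List ℕ → List ℕ → Cell → Set
Similar λ' μ x = (v⁻ μ x ℚ.< meanSlope λ') × (meanSlope λ' ℚ.≤ v⁺ μ x)

similar? : ∀ λ' μ x → Dec (Similar λ' μ x)
similar? λ' μ x = (v⁻ μ x ℚ.<? meanSlope λ') ×-dec (meanSlope λ' ℚ.≤? v⁺ μ x)

area : List ℕ → List ℕ → ℕ
area λ' μ = size λ' ∸ size μ

sim : List ℕ → List ℕ → ℕ
sim λ' μ = length (filter (similar? λ' μ) (cells μ))

MeanSimilar : List ℕ → List ℕ → Set
MeanSimilar λ' μ = ∀ x → x ∈ₚ μ → Similar λ' μ x

-- λ is triangular: positive r, s with λ_j = ⌊r - j r / s⌋ for integers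
-- 1 ≤ j ≤ s, and λ_j = 0 for j > s  (r, s rational)
Triangular : List ℕ → Set
Triangular λ' =
  Σ ℚ λ r → Σ ℚ λ s → Σ (ℚ.Positive r) λ _ → Σ (ℚ.Positive s) λ ps →
    ∀ (j : ℕ) →
      ((+ suc j ℚ./ 1) ℚ.≤ s →
         + row λ' j ≡ floor (r ℚ.- _÷_ ((+ suc j ℚ./ 1) ℚ.* r) s {{pos⇒nonZero s {{ps}}}}))
    × (s ℚ.< (+ suc j ℚ./ 1) → row λ' j ≡ 0)

-- a tableau assigns a label to every cell (only labels on cells of λ matter)
Tableau : Set
Tableau = Cell → ℕ

IsSYT : List ℕ → Tableau → Set
IsSYT λ' θ =
    (∀ x → x ∈ₚ λ' → 1 ℕ.≤ θ x × θ x ℕ.≤ size λ')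
  × (∀ x y → x ∈ₚ λ' → y ∈ₚ λ' → θ x ≡ θ y → x ≡ y)
  × (∀ k → 1 ℕ.≤ k → k ℕ.≤ size λ' → Σ Cell λ x → x ∈ₚ λ' × θ x ≡ k)
  × (∀ ℓ c → (ℓ , suc c) ∈ₚ λ' → θ (ℓ , c) ℕ.< θ (ℓ , suc c))
  × (∀ ℓ c → (suc ℓ , c) ∈ₚ λ' → θ (ℓ , c) ℕ.< θ (suc ℓ , c))

IsTriangularTableau : List ℕ → Tableau → Set
IsTriangularTableau λ' θ =
  IsSYT λ' θ ×
  (∀ k → k ℕ.≤ size λ' →
     Σ (List ℕ) λ μ → IsPartition μ × μ ⊆ₚ λ'
       × (∀ x → (x ∈ₚ μ) ⇔ (x ∈ₚ λ' × θ x ℕ.≤ k))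
       × MeanSimilar λ' μ)

IsDeficit : List ℕ → Tableau → List ℕ → Cell → Set
IsDeficit λ' θ μ d =
  Σ Cell λ c₁ → Σ Cell λ c₂ →
    c₁ ∈ₚ μ × c₂ ∈ₚ λ' × ¬ (c₂ ∈ₚ μ) × θ c₂ ℕ.< θ c₁
    × d ≡ (Data.Product.proj₁ c₁ ⊓ Data.Product.proj₁ c₂ , Data.Product.proj₂ c₁ ⊓ Data.Product.proj₂ c₂)

HasSize : (Cell → Set) → ℕ → Set
HasSize P n = Σ (List Cell) λ xs → Unique xs × length xs ≡ n × (∀ x → x ∈ xs ⇔ P x)

-- Write the mean slope of λ as p / (p + r).  A cell with arm a and leg l is similar
-- iff not p (a + 1) ≤ r l, and p a ≤ r (l + 1); both conditions are monotone in
-- (a , l), and this monotonicity is all the argument uses.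
--
-- For c ∈ λ the cells labelled at most θ c form a partition ν all of whose cells are
-- similar.  If d is a deficit cell coming from c₁ ∈ μ and c₂ ∈ λ ∖ μ, take ν for c₂:
-- then c₁ ∈ μ ∖ ν and c₂ ∈ ν ∖ μ lie one in the row and one in the column of d, so d
-- has the larger arm in one of μ, ν and the larger leg in the other, and two such
-- crossing pairs (a , l) cannot both be similar.  Conversely, if p (a + 1) ≤ r l for
-- d ∈ μ, let c₁ be the top cell of d's column in μ and c₂ the first cell right of d's
-- row.  In ν for c₁ the leg of d is at least l, so by monotonicity its arm exceeds a;
-- hence c₂ ∈ ν, i.e. θ c₂ < θ c₁.  The other failure is symmetric.  The counting
-- identity follows since the cells of μ split into the similar and the other ones.

module Submission where

open import Defs
open import Data.Nat
  using (ℕ; zero; suc; _+_; _*_; _∸_; _≤_; _<_; _≤?_; _<?_; _⊓_; _≤′_; ≤′-refl; ≤′-step; z≤n; s≤s)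
open import Data.Nat.Properties
open import Data.Nat.ListAction using (sum)
open import Data.Nat.Solver using (module +-*-Solver)
open import Data.Integer as ℤ using (+_; -[1+_])
import Data.Integer.Properties as ℤ
open import Data.Rational as ℚ using (ℚ; mkℚ; 0ℚ; 1ℚ; ½)
import Data.Rational.Properties as ℚ
open import Data.Rational.Unnormalised as ℚᵘ using (mkℚᵘ; *≤*)
import Data.Rational.Unnormalised.Properties as ℚᵘ
open import Data.List using (List; []; _∷_; length; map; concatMap; upTo; applyUpTo; drop; filter; foldr)
open import Data.List.Properties
  using (length-++; length-map; length-applyUpTo; map-applyUpTo; foldr-preservesᵇ)
open import Data.List.Membership.Propositional using (_∈_)
open import Data.List.Membership.Propositional.Properties
  using (∈-++⁻; ∈-map⁺; ∈-map⁻; ∈-concat⁺′; ∈-concat⁻′; ∈-upTo⁺; ∈-upTo⁻; ∈-filter⁺; ∈-filter⁻)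
open import Data.List.Relation.Unary.Any using (here; there)
open import Data.List.Relation.Unary.AllPairs using ([]; _∷_)
import Data.List.Relation.Unary.All as All
import Data.List.Relation.Unary.All.Properties as All
open import Data.List.Relation.Unary.Unique.Propositional using (Unique)
import Data.List.Relation.Unary.Unique.Propositional.Properties as Unique
import Algebra.Definitions as Algebra
open import Data.Product using (Σ; ∃-syntax; _×_; _,_; proj₁; proj₂; map₂)
open import Data.Product.Function.NonDependent.Propositional using (_×-⇔_)
open import Data.Sum using (inj₁; inj₂)
open import Data.Empty using (⊥-elim)
open import Function using (_∘_)
open import Function.Bundles using (_⇔_; mk⇔; Equivalence)
open import Function.Construct.Composition using (_⇔-∘_)
open import Function.Related.TypeIsomorphisms using (¬-cong-⇔)
open import Relation.Binary.PropositionalEquality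
open import Relation.Nullary using (¬_; Dec; yes; no)
open import Relation.Unary using (Decidable)
open import Relation.Unary.Properties using (∁?)

open Equivalence using (to; from)

fraction-≤⇔ : ∀ a e b f → ((+ a) ℚ./ suc e ℚ.≤ (+ b) ℚ./ suc f) ⇔ (a * suc f ≤ b * suc e)
fraction-≤⇔ a e b f = mk⇔ cross-multiply divide
  where
  a/e≃ : ℚ.toℚᵘ ((+ a) ℚ./ suc e) ℚᵘ.≃ mkℚᵘ (+ a) e
  a/e≃ = ℚ.toℚᵘ-fromℚᵘ (mkℚᵘ (+ a) e)
  b/f≃ : ℚ.toℚᵘ ((+ b) ℚ./ suc f) ℚᵘ.≃ mkℚᵘ (+ b) f
  b/f≃ = ℚ.toℚᵘ-fromℚᵘ (mkℚᵘ (+ b) f)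
  cross-multiply : (+ a) ℚ./ suc e ℚ.≤ (+ b) ℚ./ suc f → a * suc f ≤ b * suc e
  cross-multiply le with ℚᵘ.≤-respʳ-≃ b/f≃ (ℚᵘ.≤-respˡ-≃ a/e≃ (ℚ.toℚᵘ-mono-≤ le))
  ... | *≤* k rewrite sym (ℤ.pos-* a (suc f)) | sym (ℤ.pos-* b (suc e)) = ℤ.drop‿+≤+ k
  divide : a * suc f ≤ b * suc e → (+ a) ℚ./ suc e ℚ.≤ (+ b) ℚ./ suc f
  divide le = ℚ.toℚᵘ-cancel-≤ (ℚᵘ.≤-respʳ-≃ (ℚᵘ.≃-sym b/f≃) (ℚᵘ.≤-respˡ-≃ (ℚᵘ.≃-sym a/e≃)
    (*≤* (subst₂ ℤ._≤_ (ℤ.pos-* a (suc f)) (ℤ.pos-* b (suc e)) (ℤ.+≤+ le)))))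

nonNegative⇒fraction : ∀ {x} → 0ℚ ℚ.≤ x → ∃[ p ] ∃[ e ] x ≡ (+ p) ℚ./ suc e
nonNegative⇒fraction {mkℚ (+ p) e _}     _            = p , e , sym (ℚ.↥p/↧p≡p _)
nonNegative⇒fraction {mkℚ -[1+ _ ] _ _} (ℚ.*≤* ())

InUnitInterval : ℚ → Set
InUnitInterval x = 0ℚ ℚ.≤ x × x ℚ.≤ 1ℚ

fraction-inUnitInterval : ∀ {a e} → a ≤ suc e → InUnitInterval ((+ a) ℚ./ suc e)
fraction-inUnitInterval {a} {e} a≤1+e =
  from (fraction-≤⇔ 0 0 a e) z≤n ,
  from (fraction-≤⇔ a e 1 0) (subst₂ _≤_ (sym (*-identityʳ a)) (sym (+-identityʳ (suc e))) a≤1+e)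

inUnitInterval⇒fraction : ∀ {x} → InUnitInterval x →
                          ∃[ p ] ∃[ r ] ∃[ e ] (x ≡ (+ p) ℚ./ suc e × suc e ≡ p + r)
inUnitInterval⇒fraction (0≤x , x≤1) with p , e , refl ← nonNegative⇒fraction 0≤x =
  p , suc e ∸ p , e , refl , sym (m+[n∸m]≡n p≤1+e)
  where
  p≤1+e : p ≤ suc e
  p≤1+e = subst₂ _≤_ (*-identityʳ p) (+-identityʳ (suc e)) (to (fraction-≤⇔ p e 1 0) x≤1)

foldr-selective-preserves : ∀ {A : Set} {_∙_ : A → A → A} (P : A → Set) → Algebra.Selective _≡_ _∙_ →
                            ∀ {e xs} → P e → All.All P xs → P (foldr _∙_ e xs)
foldr-selective-preserves {_∙_ = _∙_} P sel = foldr-preservesᵇ {P = P} ∙-preserves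
  where
  ∙-preserves : ∀ {x y} → P x → P y → P (x ∙ y)
  ∙-preserves {x} {y} Px Py with sel x y
  ... | inj₁ x∙y≡x = subst P (sym x∙y≡x) Px
  ... | inj₂ x∙y≡y = subst P (sym x∙y≡y) Py

meanSlope-inUnitInterval : ∀ λ' → InUnitInterval (meanSlope λ')
meanSlope-inUnitInterval λ' = midpoint (extremum ℚ.⊔-sel (ℚ.≤-refl , 0≤1) v⁻-inUnitInterval)
                                       (extremum ℚ.⊓-sel (0≤1 , ℚ.≤-refl) v⁺-inUnitInterval)
  where
  0≤1 : 0ℚ ℚ.≤ 1ℚ
  0≤1 = proj₂ (fraction-inUnitInterval {0} {0} z≤n)
  v⁻-inUnitInterval : ∀ x → InUnitInterval (v⁻ λ' x)
  v⁻-inUnitInterval x = fraction-inUnitInterval (≤-trans (n≤1+n _) (s≤s (m≤n+m (leg λ' x) (arm λ' x))))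
  v⁺-inUnitInterval : ∀ x → InUnitInterval (v⁺ λ' x)
  v⁺-inUnitInterval x = fraction-inUnitInterval (s≤s (m≤n+m (leg λ' x) (arm λ' x)))
  extremum : ∀ {_∙_ e} → Algebra.Selective _≡_ _∙_ → InUnitInterval e →
             ∀ {f} → (∀ x → InUnitInterval (f x)) → InUnitInterval (foldr _∙_ e (map f (cells λ')))
  extremum sel e-in f-in =
    foldr-selective-preserves InUnitInterval sel e-in (All.map⁺ (All.universal f-in (cells λ')))
  midpoint : ∀ {x y} → InUnitInterval x → InUnitInterval y → InUnitInterval ((x ℚ.+ y) ℚ.* ½)
  midpoint (0≤x , x≤1) (0≤y , y≤1) =
    ℚ.*-monoʳ-≤-nonNeg ½ (ℚ.+-mono-≤ 0≤x 0≤y) , ℚ.*-monoʳ-≤-nonNeg ½ (ℚ.+-mono-≤ x≤1 y≤1)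

-- SlopeBelow a b says p / (p + r) ≤ b / (a + b), so SimilarAt a l says that
-- v⁻ = l / (a + l + 1) < p / (p + r) ≤ (l + 1) / (a + l + 1) = v⁺.
module Slope (p r : ℕ) where

  SlopeBelow : ℕ → ℕ → Set
  SlopeBelow a b = p * a ≤ r * b

  SlopeBelow? : ∀ a b → Dec (SlopeBelow a b)
  SlopeBelow? a b = p * a ≤? r * b

  SlopeBelow-mono : ∀ {a a′ b b′} → a′ ≤ a → b ≤ b′ → SlopeBelow a b → SlopeBelow a′ b′
  SlopeBelow-mono a′≤a b≤b′ below = ≤-trans (*-monoʳ-≤ p a′≤a) (≤-trans below (*-monoʳ-≤ r b≤b′))

  SimilarAt : ℕ → ℕ → Set
  SimilarAt a l = ¬ SlopeBelow (suc a) l × SlopeBelow a (suc l)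

  similar-arm<⇒leg≤ : ∀ {a l a′ l′} → SimilarAt a l → SimilarAt a′ l′ → a < a′ → l ≤ l′
  similar-arm<⇒leg≤ (¬below , _) (_ , below′) a<a′ =
    ≮⇒≥ (λ l′<l → ¬below (SlopeBelow-mono a<a′ l′<l below′))

  slopeBelow-similar-leg≤⇒arm< : ∀ {a l a′ l′} →
    SlopeBelow (suc a) l → SimilarAt a′ l′ → l ≤ l′ → a < a′
  slopeBelow-similar-leg≤⇒arm< below (¬below′ , _) l≤l′ =
    ≰⇒> (λ a′≤a → ¬below′ (SlopeBelow-mono (s≤s a′≤a) l≤l′ below))

  ¬slopeBelow-similar-arm≤⇒leg< : ∀ {a l a′ l′} →
    ¬ SlopeBelow a (suc l) → SimilarAt a′ l′ → a ≤ a′ → l < l′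
  ¬slopeBelow-similar-arm≤⇒leg< ¬below (_ , below′) a≤a′ =
    ≰⇒> (λ l′≤l → ¬below (SlopeBelow-mono a≤a′ (s≤s l′≤l) below′))

  cross-≤⇔ : ∀ a b → p * (a + b) ≤ b * (p + r) ⇔ SlopeBelow a b
  cross-≤⇔ a b = mk⇔
    (λ le → +-cancelʳ-≤ (p * b) (p * a) (r * b) (subst₂ _≤_ (*-distribˡ-+ p a b) b[p+r] le))
    (λ le → subst₂ _≤_ (sym (*-distribˡ-+ p a b)) (sym b[p+r]) (+-monoˡ-≤ (p * b) le))
    where
    open +-*-Solver
    b[p+r] : b * (p + r) ≡ r * b + p * b
    b[p+r] = solve 3 (λ b p r → b :* (p :+ r) := r :* b :+ p :* b) refl b p r

  slope≤fraction⇔ : ∀ {e a b n} → suc e ≡ p + r → suc n ≡ a + b →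
                    ((+ p) ℚ./ suc e ℚ.≤ (+ b) ℚ./ suc n) ⇔ SlopeBelow a b
  slope≤fraction⇔ {e} {a} {b} {n} 1+e≡p+r 1+n≡a+b =
    cross-≤⇔ a b ⇔-∘ subst₂ (λ x y → ((+ p) ℚ./ suc e ℚ.≤ (+ b) ℚ./ suc n) ⇔ (p * x ≤ b * y))
                            1+n≡a+b 1+e≡p+r (fraction-≤⇔ p e b n)

  fraction-similar⇔ : ∀ {e} → suc e ≡ p + r → ∀ a l →
    (((+ l) ℚ./ suc (a + l) ℚ.< (+ p) ℚ./ suc e) × ((+ p) ℚ./ suc e ℚ.≤ (+ suc l) ℚ./ suc (a + l)))
      ⇔ SimilarAt a l
  fraction-similar⇔ 1+e≡p+r a l =
    (¬-cong-⇔ (slope≤fraction⇔ 1+e≡p+r refl) ⇔-∘ <⇔≱) ×-⇔ slope≤fraction⇔ 1+e≡p+r (sym (+-suc a l))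
    where
    <⇔≱ : ∀ {x y} → x ℚ.< y ⇔ (¬ y ℚ.≤ x)
    <⇔≱ = mk⇔ (λ x<y y≤x → ℚ.<-irrefl refl (ℚ.<-≤-trans x<y y≤x)) ℚ.≰⇒>

  similar⇔similarAt : ∀ {λ' e} → meanSlope λ' ≡ (+ p) ℚ./ suc e → suc e ≡ p + r →
                      ∀ ν x → Similar λ' ν x ⇔ SimilarAt (arm ν x) (leg ν x)
  similar⇔similarAt slope≡ 1+e≡p+r ν x =
    subst (λ m → ((v⁻ ν x ℚ.< m) × (m ℚ.≤ v⁺ ν x)) ⇔ SimilarAt (arm ν x) (leg ν x)) (sym slope≡)
          (fraction-similar⇔ 1+e≡p+r (arm ν x) (leg ν x))

row-antitone : ∀ ν → IsPartition ν → ∀ {i i′} → i ≤ i′ → row ν i′ ≤ row ν i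
row-antitone ν ν-partition {i} i≤i′ = go (≤⇒≤′ i≤i′)
  where
  go : ∀ {i′} → i ≤′ i′ → row ν i′ ≤ row ν i
  go ≤′-refl         = ≤-refl
  go (≤′-step i≤′i′) = ≤-trans (ν-partition _) (go i≤′i′)

∈ₚ-downClosed : ∀ ν → IsPartition ν → ∀ {i j i′ j′} → (i′ , j′) ∈ₚ ν → i ≤ i′ → j ≤ j′ → (i , j) ∈ₚ ν
∈ₚ-downClosed ν ν-partition x∈ν i≤i′ j≤j′ =
  <-≤-trans (≤-<-trans j≤j′ x∈ν) (row-antitone ν ν-partition i≤i′)

∈ₚ⇒<length : ∀ ν {i j} → (i , j) ∈ₚ ν → i < length ν
∈ₚ⇒<length (_ ∷ _) {zero}  _   = s≤s z≤n
∈ₚ⇒<length (_ ∷ ν) {suc i} x∈ν = s≤s (∈ₚ⇒<length ν x∈ν)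

row-∈⇔ : ∀ ν {i j} → (i , j) ∈ₚ ν → ∀ j′ → (i , j′) ∈ₚ ν ⇔ j′ ≤ j + arm ν (i , j)
row-∈⇔ ν {i} {j} x∈ν j′ =
  mk⇔ (λ y∈ν → ≤-pred (subst (suc j′ ≤_) (sym end) y∈ν)) (λ le → subst (suc j′ ≤_) end (s≤s le))
  where
  end : suc (j + arm ν (i , j)) ≡ row ν i
  end = m+[n∸m]≡n x∈ν

drop-applyUpTo : ∀ {A : Set} (f : ℕ → A) k n →
                 drop k (applyUpTo f n) ≡ applyUpTo (λ x → f (k + x)) (n ∸ k)
drop-applyUpTo f zero    n       = refl
drop-applyUpTo f (suc k) zero    = refl
drop-applyUpTo f (suc k) (suc n) = drop-applyUpTo (λ x → f (suc x)) k n

module _ {P : ℕ → Set} (P? : Decidable P) where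

  ≤-length-filter-applyUpTo : ∀ g {n t} → t ≤ n → (∀ {x} → x < t → P (g x)) →
                              t ≤ length (filter P? (applyUpTo g n))
  ≤-length-filter-applyUpTo g {t = zero} _ _ = z≤n
  ≤-length-filter-applyUpTo g {suc n} {suc t} (s≤s t≤n) hits with P? (g 0)
  ... | yes _   = s≤s (≤-length-filter-applyUpTo (λ x → g (suc x)) t≤n (λ x<t → hits (s≤s x<t)))
  ... | no miss = ⊥-elim (miss (hits (s≤s z≤n)))

  length-filter-applyUpTo-≤ : ∀ g n {t} → (∀ {x} → t ≤ x → ¬ P (g x)) →
                              length (filter P? (applyUpTo g n)) ≤ t
  length-filter-applyUpTo-≤ g zero    _ = z≤n
  length-filter-applyUpTo-≤ g (suc n) {t} misses with P? (g 0) | t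
  ... | yes hit | zero  = ⊥-elim (misses z≤n hit)
  ... | yes _   | suc t =
    s≤s (length-filter-applyUpTo-≤ (λ x → g (suc x)) n (λ t≤x → misses (s≤s t≤x)))
  ... | no _    | t     =
    length-filter-applyUpTo-≤ (λ x → g (suc x)) n (λ t≤x → misses (m≤n⇒m≤1+n t≤x))

leg-as-count : ∀ ν i j →
  leg ν (i , j) ≡ length (filter (λ ℓ → j <? row ν ℓ) (applyUpTo (_+_ (suc i)) (length ν ∸ suc i)))
leg-as-count ν i j =
  cong (length ∘ filter (λ ℓ → j <? row ν ℓ)) (drop-applyUpTo (λ x → x) (suc i) (length ν))

≤+leg : ∀ ν → IsPartition ν → ∀ {i i′ j} → (i′ , j) ∈ₚ ν → i′ ≤ i + leg ν (i , j)
≤+leg ν ν-partition {i} {i′} {j} y∈ν with i′ ≤? i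
... | yes i′≤i = ≤-trans i′≤i (m≤m+n i _)
... | no i′≰i with t , refl ← m≤n⇒∃[o]m+o≡n (≰⇒> i′≰i) =
  subst (_≤ i + leg ν (i , j)) (+-suc i t) (+-monoʳ-≤ i (subst (suc t ≤_) (sym (leg-as-count ν i j)) count))
  where
  count : suc t ≤ length (filter (λ ℓ → j <? row ν ℓ) (applyUpTo (_+_ (suc i)) (length ν ∸ suc i)))
  count = ≤-length-filter-applyUpTo (λ ℓ → j <? row ν ℓ) (_+_ (suc i))
    (m+n≤o⇒m≤o∸n (suc t) (subst (_≤ length ν) (cong suc (+-comm (suc i) t)) (∈ₚ⇒<length ν y∈ν)))
    (λ x<t → <-≤-trans y∈ν (row-antitone ν ν-partition (+-monoʳ-≤ (suc i) (≤-pred x<t))))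

+leg< : ∀ ν → IsPartition ν → ∀ {i i′ j} → i < i′ → ¬ (i′ , j) ∈ₚ ν → i + leg ν (i , j) < i′
+leg< ν ν-partition {i} {j = j} i<i′ y∉ν with t , refl ← m≤n⇒∃[o]m+o≡n i<i′ =
  s≤s (+-monoʳ-≤ i (subst (_≤ t) (sym (leg-as-count ν i j)) count))
  where
  count : length (filter (λ ℓ → j <? row ν ℓ) (applyUpTo (_+_ (suc i)) (length ν ∸ suc i))) ≤ t
  count = length-filter-applyUpTo-≤ (λ ℓ → j <? row ν ℓ) (_+_ (suc i)) (length ν ∸ suc i)
    (λ t≤x x∈ν → y∉ν (<-≤-trans x∈ν (row-antitone ν ν-partition (+-monoʳ-≤ (suc i) t≤x))))

column-∈⇔ : ∀ ν → IsPartition ν → ∀ {i j} → (i , j) ∈ₚ ν → ∀ i′ → (i′ , j) ∈ₚ ν ⇔ i′ ≤ i + leg ν (i , j)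
column-∈⇔ ν ν-partition {i} {j} x∈ν i′ = mk⇔ (≤+leg ν ν-partition) ≤+leg⇒∈
  where
  ≤+leg⇒∈ : i′ ≤ i + leg ν (i , j) → (i′ , j) ∈ₚ ν
  ≤+leg⇒∈ le with j <? row ν i′ | i′ ≤? i
  ... | yes y∈ν | _        = y∈ν
  ... | no y∉ν  | yes i′≤i = ⊥-elim (y∉ν (∈ₚ-downClosed ν ν-partition x∈ν i′≤i ≤-refl))
  ... | no y∉ν  | no i′≰i  = ⊥-elim (<⇒≱ (+leg< ν ν-partition (≰⇒> i′≰i) y∉ν) le)

arm-< : ∀ μ ν {i j j′} → (i , j) ∈ₚ μ → (i , j) ∈ₚ ν → (i , j′) ∈ₚ μ → ¬ (i , j′) ∈ₚ ν →
        arm ν (i , j) < arm μ (i , j)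
arm-< μ ν {i} {j} {j′} x∈μ x∈ν y∈μ y∉ν = +-cancelˡ-< j _ _
  (<-≤-trans (≰⇒> (λ le → y∉ν (from (row-∈⇔ ν x∈ν j′) le))) (to (row-∈⇔ μ x∈μ j′) y∈μ))

leg-< : ∀ μ ν → IsPartition μ → IsPartition ν →
        ∀ {i j i′} → (i , j) ∈ₚ μ → (i , j) ∈ₚ ν → (i′ , j) ∈ₚ μ → ¬ (i′ , j) ∈ₚ ν →
        leg ν (i , j) < leg μ (i , j)
leg-< μ ν μ-partition ν-partition {i} {j} {i′} x∈μ x∈ν y∈μ y∉ν = +-cancelˡ-< i _ _
  (<-≤-trans (≰⇒> (λ le → y∉ν (from (column-∈⇔ ν ν-partition x∈ν i′) le))) (≤+leg μ μ-partition y∈μ))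

module Deficits (p r : ℕ) (λ' : List ℕ) (θ : Tableau) where
  open Slope p r

  SimilarCell : List ℕ → Cell → Set
  SimilarCell ν x = SimilarAt (arm ν x) (leg ν x)

  crossing⇒¬similar : ∀ μ ν → IsPartition μ → IsPartition ν → ∀ {i j i′ j′} →
    (i , j) ∈ₚ μ → (i , j) ∈ₚ ν → (i , j′) ∈ₚ μ → ¬ (i , j′) ∈ₚ ν → (i′ , j) ∈ₚ ν → ¬ (i′ , j) ∈ₚ μ →
    SimilarCell ν (i , j) → ¬ SimilarCell μ (i , j)
  crossing⇒¬similar μ ν μ-partition ν-partition x∈μ x∈ν y∈μ y∉ν z∈ν z∉μ similar-ν similar-μ =
    <⇒≱ (leg-< ν μ ν-partition μ-partition x∈ν x∈μ z∈ν z∉μ)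
        (similar-arm<⇒leg≤ similar-ν similar-μ (arm-< μ ν x∈μ x∈ν y∈μ y∉ν))

  record Prefix (c : Cell) : Set where
    field
      shape       : List ℕ
      isPartition : IsPartition shape
      ∈-shape⇔    : ∀ x → x ∈ₚ shape ⇔ (x ∈ₚ λ' × θ x ≤ θ c)
      allSimilar  : ∀ x → x ∈ₚ shape → SimilarCell shape x

  module _ (θ-injective : ∀ x y → x ∈ₚ λ' → y ∈ₚ λ' → θ x ≡ θ y → x ≡ y)
           (prefix : ∀ c → c ∈ₚ λ' → Prefix c)
           (μ : List ℕ) (μ-partition : IsPartition μ) (μ⊆λ : μ ⊆ₚ λ') where

    ∈μ⇒∈λ : ∀ {x} → x ∈ₚ μ → x ∈ₚ λ'
    ∈μ⇒∈λ {ℓ , _} x∈μ = <-≤-trans x∈μ (μ⊆λ ℓ)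

    deficit⇒nonSimilar : ∀ d → IsDeficit λ' θ μ d → d ∈ₚ μ × ¬ SimilarCell μ d
    deficit⇒nonSimilar _ ((i₁ , j₁) , (i₂ , j₂) , c₁∈μ , c₂∈λ , c₂∉μ , θc₂<θc₁ , refl) =
      ∈ₚ-downClosed μ μ-partition c₁∈μ (m⊓n≤m i₁ i₂) (m⊓n≤m j₁ j₂) , nonSimilar (i₁ ≤? i₂) (j₁ ≤? j₂)
      where
      open Prefix (prefix (i₂ , j₂) c₂∈λ) renaming (shape to ν)
      c₂∈ν : (i₂ , j₂) ∈ₚ ν
      c₂∈ν = from (∈-shape⇔ _) (c₂∈λ , ≤-refl)
      c₁∉ν : ¬ (i₁ , j₁) ∈ₚ ν
      c₁∉ν c₁∈ν = <⇒≱ θc₂<θc₁ (proj₂ (to (∈-shape⇔ _) c₁∈ν))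
      nonSimilar : Dec (i₁ ≤ i₂) → Dec (j₁ ≤ j₂) → ¬ SimilarCell μ (i₁ ⊓ i₂ , j₁ ⊓ j₂)
      nonSimilar (yes i₁≤i₂) (yes j₁≤j₂) =
        ⊥-elim (c₁∉ν (∈ₚ-downClosed ν isPartition c₂∈ν i₁≤i₂ j₁≤j₂))
      nonSimilar (no i₁≰i₂) (no j₁≰j₂) =
        ⊥-elim (c₂∉μ (∈ₚ-downClosed μ μ-partition c₁∈μ (<⇒≤ (≰⇒> i₁≰i₂)) (<⇒≤ (≰⇒> j₁≰j₂))))
      nonSimilar (yes i₁≤i₂) (no j₁≰j₂) rewrite m≤n⇒m⊓n≡m i₁≤i₂ | m≥n⇒m⊓n≡n (<⇒≤ (≰⇒> j₁≰j₂)) =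
        crossing⇒¬similar μ ν μ-partition isPartition d∈μ d∈ν c₁∈μ c₁∉ν c₂∈ν c₂∉μ (allSimilar _ d∈ν)
        where
        d∈μ : (i₁ , j₂) ∈ₚ μ
        d∈μ = ∈ₚ-downClosed μ μ-partition c₁∈μ ≤-refl (<⇒≤ (≰⇒> j₁≰j₂))
        d∈ν : (i₁ , j₂) ∈ₚ ν
        d∈ν = ∈ₚ-downClosed ν isPartition c₂∈ν i₁≤i₂ ≤-refl
      nonSimilar (no i₁≰i₂) (yes j₁≤j₂) rewrite m≥n⇒m⊓n≡n (<⇒≤ (≰⇒> i₁≰i₂)) | m≤n⇒m⊓n≡m j₁≤j₂ =
        λ similar-μ → crossing⇒¬similar ν μ isPartition μ-partition d∈ν d∈μ c₂∈ν c₂∉μ c₁∈μ c₁∉ν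
                                          similar-μ (allSimilar _ d∈ν)
        where
        d∈μ : (i₂ , j₁) ∈ₚ μ
        d∈μ = ∈ₚ-downClosed μ μ-partition c₁∈μ (<⇒≤ (≰⇒> i₁≰i₂)) ≤-refl
        d∈ν : (i₂ , j₁) ∈ₚ ν
        d∈ν = ∈ₚ-downClosed ν isPartition c₂∈ν ≤-refl j₁≤j₂

    ordered⇒deficit : ∀ {c₁ c₂} → c₁ ∈ₚ μ → ¬ c₂ ∈ₚ μ → c₂ ∈ₚ λ' × θ c₂ ≤ θ c₁ →
                      IsDeficit λ' θ μ (proj₁ c₁ ⊓ proj₁ c₂ , proj₂ c₁ ⊓ proj₂ c₂)
    ordered⇒deficit {c₁} {c₂} c₁∈μ c₂∉μ (c₂∈λ , θc₂≤θc₁) =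
      c₁ , c₂ , c₁∈μ , c₂∈λ , c₂∉μ , ≤∧≢⇒< θc₂≤θc₁ θc₂≢θc₁ , refl
      where
      θc₂≢θc₁ : θ c₂ ≢ θ c₁
      θc₂≢θc₁ eq = c₂∉μ (subst (_∈ₚ μ) (θ-injective c₁ c₂ (∈μ⇒∈λ c₁∈μ) c₂∈λ (sym eq)) c₁∈μ)

    slopeBelow⇒deficit : ∀ {i j} → (i , j) ∈ₚ μ → SlopeBelow (suc (arm μ (i , j))) (leg μ (i , j)) →
                         IsDeficit λ' θ μ (i , j)
    slopeBelow⇒deficit {i} {j} d∈μ below =
      subst (IsDeficit λ' θ μ) (cong₂ _,_ (m≥n⇒m⊓n≡n (m≤m+n i l)) (m≤n⇒m⊓n≡m (m≤m+n j (suc a))))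
        (ordered⇒deficit c₁∈μ c₂∉μ (to (∈-shape⇔ _) c₂∈ν))
      where
      a l : ℕ
      a = arm μ (i , j)
      l = leg μ (i , j)
      c₁∈μ : (i + l , j) ∈ₚ μ
      c₁∈μ = from (column-∈⇔ μ μ-partition d∈μ (i + l)) ≤-refl
      c₂∉μ : ¬ (i , j + suc a) ∈ₚ μ
      c₂∉μ c₂∈μ = 1+n≰n (+-cancelˡ-≤ j (suc a) a (to (row-∈⇔ μ d∈μ (j + suc a)) c₂∈μ))
      open Prefix (prefix (i + l , j) (∈μ⇒∈λ c₁∈μ)) renaming (shape to ν)
      c₁∈ν : (i + l , j) ∈ₚ ν
      c₁∈ν = from (∈-shape⇔ _) (∈μ⇒∈λ c₁∈μ , ≤-refl)
      d∈ν : (i , j) ∈ₚ ν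
      d∈ν = ∈ₚ-downClosed ν isPartition c₁∈ν (m≤m+n i l) ≤-refl
      a<arm-ν : a < arm ν (i , j)
      a<arm-ν = slopeBelow-similar-leg≤⇒arm< below (allSimilar _ d∈ν)
                  (+-cancelˡ-≤ i l _ (to (column-∈⇔ ν isPartition d∈ν (i + l)) c₁∈ν))
      c₂∈ν : (i , j + suc a) ∈ₚ ν
      c₂∈ν = from (row-∈⇔ ν d∈ν (j + suc a)) (+-monoʳ-≤ j a<arm-ν)

    ¬slopeBelow⇒deficit : ∀ {i j} → (i , j) ∈ₚ μ → ¬ SlopeBelow (arm μ (i , j)) (suc (leg μ (i , j))) →
                          IsDeficit λ' θ μ (i , j)
    ¬slopeBelow⇒deficit {i} {j} d∈μ ¬below =
      subst (IsDeficit λ' θ μ) (cong₂ _,_ (m≤n⇒m⊓n≡m (m≤m+n i (suc l))) (m≥n⇒m⊓n≡n (m≤m+n j a)))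
        (ordered⇒deficit c₁∈μ c₂∉μ (to (∈-shape⇔ _) c₂∈ν))
      where
      a l : ℕ
      a = arm μ (i , j)
      l = leg μ (i , j)
      c₁∈μ : (i , j + a) ∈ₚ μ
      c₁∈μ = from (row-∈⇔ μ d∈μ (j + a)) ≤-refl
      c₂∉μ : ¬ (i + suc l , j) ∈ₚ μ
      c₂∉μ c₂∈μ = 1+n≰n (+-cancelˡ-≤ i (suc l) l (to (column-∈⇔ μ μ-partition d∈μ (i + suc l)) c₂∈μ))
      open Prefix (prefix (i , j + a) (∈μ⇒∈λ c₁∈μ)) renaming (shape to ν)
      c₁∈ν : (i , j + a) ∈ₚ ν
      c₁∈ν = from (∈-shape⇔ _) (∈μ⇒∈λ c₁∈μ , ≤-refl)
      d∈ν : (i , j) ∈ₚ ν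
      d∈ν = ∈ₚ-downClosed ν isPartition c₁∈ν ≤-refl (m≤m+n j a)
      l<leg-ν : l < leg ν (i , j)
      l<leg-ν = ¬slopeBelow-similar-arm≤⇒leg< ¬below (allSimilar _ d∈ν)
                  (+-cancelˡ-≤ j a _ (to (row-∈⇔ ν d∈ν (j + a)) c₁∈ν))
      c₂∈ν : (i + suc l , j) ∈ₚ ν
      c₂∈ν = from (column-∈⇔ ν isPartition d∈ν (i + suc l)) (+-monoʳ-≤ i l<leg-ν)

    deficit⇔nonSimilar : ∀ d → IsDeficit λ' θ μ d ⇔ (d ∈ₚ μ × ¬ SimilarCell μ d)
    deficit⇔nonSimilar d = mk⇔ (deficit⇒nonSimilar d) nonSimilar⇒deficit
      where
      nonSimilar⇒deficit : d ∈ₚ μ × ¬ SimilarCell μ d → IsDeficit λ' θ μ d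
      nonSimilar⇒deficit (d∈μ , ¬similar) with SlopeBelow? (suc (arm μ d)) (leg μ d)
      ... | yes below = slopeBelow⇒deficit d∈μ below
      ... | no ¬below = ¬slopeBelow⇒deficit d∈μ (λ below′ → ¬similar (¬below , below′))

rowCells : (ℕ → ℕ) → ℕ → List Cell
rowCells f ℓ = map (ℓ ,_) (upTo (f ℓ))

∈-concatMap-rowCells⇒∈ : ∀ f ℓs {x} → x ∈ concatMap (rowCells f) ℓs → proj₁ x ∈ ℓs
∈-concatMap-rowCells⇒∈ f (ℓ ∷ ℓs) x∈ with ∈-++⁻ (rowCells f ℓ) x∈
... | inj₁ x∈row with _ , _ , refl ← ∈-map⁻ (ℓ ,_) x∈row = here refl
... | inj₂ x∈rest = there (∈-concatMap-rowCells⇒∈ f ℓs x∈rest)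

concatMap-rowCells-unique : ∀ f {ℓs} → Unique ℓs → Unique (concatMap (rowCells f) ℓs)
concatMap-rowCells-unique f {[]}     _                                 = []
concatMap-rowCells-unique f {ℓ ∷ ℓs} ℓ∷ℓs-unique@(_ ∷ ℓs-unique) =
  Unique.++⁺ (Unique.map⁺ (cong proj₂) (Unique.upTo⁺ (f ℓ))) (concatMap-rowCells-unique f ℓs-unique) disjoint
  where
  disjoint : ∀ {x} → ¬ (x ∈ rowCells f ℓ × x ∈ concatMap (rowCells f) ℓs)
  disjoint (x∈row , x∈rest) with _ , _ , refl ← ∈-map⁻ (ℓ ,_) x∈row =
    Unique.Unique[x∷xs]⇒x∉xs ℓ∷ℓs-unique (∈-concatMap-rowCells⇒∈ f ℓs x∈rest)

length-concatMap-rowCells : ∀ f ℓs → length (concatMap (rowCells f) ℓs) ≡ sum (map f ℓs)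
length-concatMap-rowCells f []       = refl
length-concatMap-rowCells f (ℓ ∷ ℓs) =
  trans (length-++ (rowCells f ℓ))
        (cong₂ _+_ (trans (length-map _ (upTo (f ℓ))) (length-applyUpTo _ (f ℓ)))
                   (length-concatMap-rowCells f ℓs))

applyUpTo-row : ∀ μ → applyUpTo (row μ) (length μ) ≡ μ
applyUpTo-row []      = refl
applyUpTo-row (x ∷ μ) = cong (x ∷_) (applyUpTo-row μ)

∈-cells⇔ : ∀ μ x → x ∈ cells μ ⇔ x ∈ₚ μ
∈-cells⇔ μ (ℓ , c) = mk⇔ cells⁻ cells⁺
  where
  cells⁺ : (ℓ , c) ∈ₚ μ → (ℓ , c) ∈ cells μ
  cells⁺ x∈μ = ∈-concat⁺′ (∈-map⁺ (ℓ ,_) (∈-upTo⁺ x∈μ))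
                          (∈-map⁺ (rowCells (row μ)) (∈-upTo⁺ (∈ₚ⇒<length μ x∈μ)))
  cells⁻ : (ℓ , c) ∈ cells μ → (ℓ , c) ∈ₚ μ
  cells⁻ x∈ with _ , x∈row , row∈ ← ∈-concat⁻′ (map (rowCells (row μ)) (upTo (length μ))) x∈
             with ℓ′ , _ , refl ← ∈-map⁻ (rowCells (row μ)) row∈
             with _ , c<row , refl ← ∈-map⁻ (ℓ′ ,_) x∈row = ∈-upTo⁻ c<row

cells-unique : ∀ μ → Unique (cells μ)
cells-unique μ = concatMap-rowCells-unique (row μ) (Unique.upTo⁺ (length μ))

length-cells : ∀ μ → length (cells μ) ≡ size μ
length-cells μ = trans (length-concatMap-rowCells (row μ) (upTo (length μ)))
  (cong sum (trans (map-applyUpTo (λ x → x) (row μ) (length μ)) (applyUpTo-row μ)))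

size-mono : ∀ μ λ' → μ ⊆ₚ λ' → size μ ≤ size λ'
size-mono []      _        _   = z≤n
size-mono (_ ∷ μ) []       μ⊆λ = +-mono-≤ (μ⊆λ 0) (size-mono μ [] (λ i → μ⊆λ (suc i)))
size-mono (_ ∷ μ) (_ ∷ λ') μ⊆λ = +-mono-≤ (μ⊆λ 0) (size-mono μ λ' (λ i → μ⊆λ (suc i)))

HasSize-resp-⇔ : ∀ {P Q n} → (∀ x → P x ⇔ Q x) → HasSize Q n → HasSize P n
HasSize-resp-⇔ P⇔Q (xs , xs-unique , length≡ , ∈xs⇔Q) =
  xs , xs-unique , length≡ , λ x → mk⇔ (from (P⇔Q x) ∘ to (∈xs⇔Q x)) (from (∈xs⇔Q x) ∘ to (P⇔Q x))

module _ {A : Set} {P : A → Set} (P? : Decidable P) where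

  length-filter+length-filter-∁ : ∀ xs → length (filter P? xs) + length (filter (∁? P?) xs) ≡ length xs
  length-filter+length-filter-∁ []       = refl
  length-filter+length-filter-∁ (x ∷ xs) with P? x
  ... | yes _ = cong suc (length-filter+length-filter-∁ xs)
  ... | no _  = trans (+-suc _ _) (cong suc (length-filter+length-filter-∁ xs))

module _ {P : Cell → Set} (P? : Decidable P) where

  size-decomposition : ∀ λ' μ → μ ⊆ₚ λ' →
    size λ' ≡ area λ' μ + length (filter P? (cells μ)) + length (filter (∁? P?) (cells μ))
  size-decomposition λ' μ μ⊆λ = sym (begin
    area λ' μ + length (filter P? (cells μ)) + length (filter (∁? P?) (cells μ))
      ≡⟨ +-assoc (area λ' μ) _ _ ⟩
    area λ' μ + (length (filter P? (cells μ)) + length (filter (∁? P?) (cells μ)))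
      ≡⟨ cong (_+_ (area λ' μ)) (trans (length-filter+length-filter-∁ P? (cells μ)) (length-cells μ)) ⟩
    size λ' ∸ size μ + size μ
      ≡⟨ m∸n+n≡m (size-mono μ λ' μ⊆λ) ⟩
    size λ' ∎)
    where open ≡-Reasoning

  ∁-hasSize : ∀ μ → HasSize (λ x → x ∈ₚ μ × ¬ P x) (length (filter (∁? P?) (cells μ)))
  ∁-hasSize μ = filter (∁? P?) (cells μ) , Unique.filter⁺ (∁? P?) (cells-unique μ) , refl , λ x → mk⇔
    (λ x∈ → let x∈cells , ¬Px = ∈-filter⁻ (∁? P?) x∈ in to (∈-cells⇔ μ x) x∈cells , ¬Px)
    (λ (x∈μ , ¬Px) → ∈-filter⁺ (∁? P?) (from (∈-cells⇔ μ x) x∈μ) ¬Px)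

triangularTableau-deficit⇔nonSimilar :
  ∀ λ' θ → IsTriangularTableau λ' θ → ∀ p r e → meanSlope λ' ≡ (+ p) ℚ./ suc e → suc e ≡ p + r →
  ∀ μ → IsPartition μ → μ ⊆ₚ λ' → ∀ d → IsDeficit λ' θ μ d ⇔ (d ∈ₚ μ × ¬ Similar λ' μ d)
triangularTableau-deficit⇔nonSimilar λ' θ ((θ-bounded , θ-injective , _) , prefixes) p r e slope≡ 1+e≡p+r
                                     μ μ-partition μ⊆λ d =
  mk⇔ (map₂ (_∘ to similar⇔) ∘ to deficit⇔) (from deficit⇔ ∘ map₂ (_∘ from similar⇔))
  where
  open Slope p r
  open Deficits p r λ' θ
  prefix : ∀ c → c ∈ₚ λ' → Prefix c
  prefix c c∈λ =
    let ν , ν-partition , _ , ∈ν⇔ , meanSimilar = prefixes (θ c) (proj₂ (θ-bounded c c∈λ))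
    in record { shape = ν ; isPartition = ν-partition ; ∈-shape⇔ = ∈ν⇔
              ; allSimilar = λ x x∈ν → to (similar⇔similarAt {λ'} slope≡ 1+e≡p+r ν x) (meanSimilar x x∈ν) }
  similar⇔ : Similar λ' μ d ⇔ SimilarCell μ d
  similar⇔ = similar⇔similarAt {λ'} slope≡ 1+e≡p+r μ d
  deficit⇔ : IsDeficit λ' θ μ d ⇔ (d ∈ₚ μ × ¬ SimilarCell μ d)
  deficit⇔ = deficit⇔nonSimilar θ-injective prefix μ μ-partition μ⊆λ d

-- IsPartition λ' and Triangular λ' only guarantee that θ exists; the proof uses θ alone.
proposition3p6 : (λ' : List ℕ) → IsPartition λ' → Triangular λ' →
    (θ : Tableau) → IsTriangularTableau λ' θ →
    (μ : List ℕ) → IsPartition μ → μ ⊆ₚ λ' →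
    (∀ d → IsDeficit λ' θ μ d ⇔ (d ∈ₚ μ × ¬ Similar λ' μ d))
    × Σ ℕ (λ n → HasSize (IsDeficit λ' θ μ) n × size λ' ≡ area λ' μ + sim λ' μ + n)
proposition3p6 λ' _ _ θ θ-triangular μ μ-partition μ⊆λ =
  deficit⇔ , length (filter (∁? (similar? λ' μ)) (cells μ)) ,
  HasSize-resp-⇔ deficit⇔ (∁-hasSize (similar? λ' μ) μ) , size-decomposition (similar? λ' μ) λ' μ μ⊆λ
  where
  deficit⇔ : ∀ d → IsDeficit λ' θ μ d ⇔ (d ∈ₚ μ × ¬ Similar λ' μ d)
  deficit⇔ =
    let p , r , e , slope≡ , 1+e≡p+r = inUnitInterval⇒fraction (meanSlope-inUnitInterval λ')
    in triangularTableau-deficit⇔nonSimilar λ' θ θ-triangular p r e slope≡ 1+e≡p+r μ μ-partition μ⊆λ
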